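{- Let $n$ be a positive integer. In the order ideal game $\mathcal{G}(\mathrm{ASM}_n,\mathcal{OI})$, the Grundy value of $(x,y,z)\in\mathrm{ASM}_n$ is $g(x,y,z)=1$ if $\pi(x,y,z)=(0,0)$ or $\pi(x,y,z)\in\{(2k+1,k),(2k+1,k+1)\}$ for some $k\in\mathbb{Z}_{\ge0}$, and $g(x,y,z)=0$ otherwise, where $\pi(x,y,z)=(n-2-(x+y),\,z)$.
   Context: $\mathrm{ASM}_n=\{(x,y,z)\in\mathbb{Z}_{\ge0}^3 : x+y+z\le n-2\}$, partially ordered by $(x,y,z)\le(x_0,y_0,z_0)$ iff $x\ge x_0$, $y\ge y_0$, $z\le z_0$ and $x+y+z\ge x_0+y_0+z_0$. For $\mathbf{x}\in\mathrm{ASM}_n$, $\Lambda_{\mathbf{x}}=\{\mathbf{y}\in\mathrm{ASM}_n:\mathbf{y}\le\mathbf{x}\}$ is the principal order ideal, and $\mathcal{OI}=\{\Lambda_{\mathbf{x}}:\mathbf{x}\in\mathrm{ASM}_n\}$. Coin-turning game $\mathcal{G}(X,\mathcal{T})$ (for a finite poset $X$ and a family $\mathcal{T}$ of nonempty subsets each with a maximum): a position is $H\subseteq X$; a move chooses $T\in\mathcal{T}$ with $\max T\in H$ and replaces $H$ by $H\triangle T$; a player unable to move loses. The Grundy value $g(\mathbf{x})$ is the Sprague–Grundy value of the position $\{\mathbf{x}\}$; equivalently $g(\mathbf{x})=\operatorname{mex}\{\bigoplus_{t\in T\setminus\{\mathbf{x}\}}g(t):T\in\mathcal{T},\max T=\mathbf{x}\}$,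 with $\oplus$ the nim-sum (bitwise XOR) and $\operatorname{mex}$ the least nonnegative integer not in the set. -}

module Defs where

open import Data.Nat using (ℕ; zero; suc; _+_; _*_; _∸_; _≤_; _<_; _≤?_; _≟_)
open import Data.Nat.DivMod using (_/_; _%_)
open import Data.Bool using (Bool; true; false; if_then_else_)
open import Data.List using (List; []; _∷_; upTo; concatMap; filter; foldr)
open import Data.Product using (_×_; _,_; ∃-syntax; Σ-syntax)
open import Data.Sum using (_⊎_)
open import Relation.Nullary using (¬_; Dec; yes; no)
open import Relation.Nullary.Decidable using (_×-dec_; ¬?)
open import Relation.Binary.PropositionalEquality using (_≡_)

-- binary digits, least significant first; the fuel argument (≥ the
-- number itself) only ensures termination
bits : ℕ → ℕ → List Bool
bits zero    m = []
bits (suc f) zero = []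
bits (suc f) m@(suc _) = (m % 2 Data.Nat.≡ᵇ 1) ∷ bits f (m / 2)

fromBits : List Bool → ℕ
fromBits []       = 0
fromBits (b ∷ bs) = (if b then 1 else 0) + 2 * fromBits bs

xorBits : List Bool → List Bool → List Bool
xorBits []       cs       = cs
xorBits bs       []       = bs
xorBits (b ∷ bs) (c ∷ cs) = Data.Bool._xor_ b c ∷ xorBits bs cs

_⊕_ : ℕ → ℕ → ℕ
a ⊕ b = fromBits (xorBits (bits a a) (bits b b))

infixl 6 _⊕_

Pt : Set
Pt = ℕ × ℕ × ℕ

InASM : ℕ → Pt → Set
InASM n (x , y , z) = x + y + z ≤ n ∸ 2

_≼_ : Pt → Pt → Set
(x , y , z) ≼ (x₀ , y₀ , z₀) =
  x₀ ≤ x × y₀ ≤ y × z ≤ z₀ × x₀ + y₀ + z₀ ≤ x + y + z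

_≼?_ : (p q : Pt) → Dec (p ≼ q)
(x , y , z) ≼? (x₀ , y₀ , z₀) =
  (x₀ ≤? x) ×-dec (y₀ ≤? y) ×-dec (z ≤? z₀) ×-dec (x₀ + y₀ + z₀ ≤? x + y + z)

_≟Pt_ : (p q : Pt) → Dec (p ≡ q)
(x , y , z) ≟Pt (x' , y' , z') with x ≟ x' | y ≟ y' | z ≟ z'
... | yes Relation.Binary.PropositionalEquality.refl
    | yes Relation.Binary.PropositionalEquality.refl
    | yes Relation.Binary.PropositionalEquality.refl = yes Relation.Binary.PropositionalEquality.refl
... | no ne | _ | _ = no (λ { Relation.Binary.PropositionalEquality.refl → ne Relation.Binary.PropositionalEquality.refl })
... | yes _ | no ne | _ = no (λ { Relation.Binary.PropositionalEquality.refl → ne Relation.Binary.PropositionalEquality.refl })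
... | yes _ | yes _ | no ne = no (λ { Relation.Binary.PropositionalEquality.refl → ne Relation.Binary.PropositionalEquality.refl })

-- duplicate-free enumeration of ASM_n
asmList : ℕ → List Pt
asmList n =
  filter (λ { (x , y , z) → x + y + z ≤? n ∸ 2 })
    (concatMap (λ x → concatMap (λ y → Data.List.map (λ z → (x , y , z))
       (upTo (suc (n ∸ 2)))) (upTo (suc (n ∸ 2)))) (upTo (suc (n ∸ 2))))

InΛ : ℕ → Pt → Pt → Set
InΛ n y t = InASM n t × t ≼ y

-- T ∈ OI (given as T = Λ_y) has maximum p
HasMax : ℕ → Pt → Pt → Set
HasMax n y p = InΛ n y p × (∀ t → InΛ n y t → t ≼ p)

xorOver : ℕ → (Pt → ℕ) → Pt → Pt → ℕ
xorOver n g y p =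
  foldr (λ t acc → g t ⊕ acc) 0
    (filter (λ t → (t ≼? y) ×-dec ¬? (t ≟Pt p)) (asmList n))

-- the set of options' values from the single-coin position {p}
OptionValue : ℕ → (Pt → ℕ) → Pt → ℕ → Set
OptionValue n g p v =
  ∃[ y ] (InASM n y × HasMax n y p × v ≡ xorOver n g y p)

IsMex : (ℕ → Set) → ℕ → Set
IsMex S m = ¬ S m × (∀ k → k < m → S k)

IsGrundy : ℕ → (Pt → ℕ) → Set
IsGrundy n g = ∀ p → InASM n p → IsMex (OptionValue n g p) (g p)

π : ℕ → Pt → ℕ × ℕ
π n (x , y , z) = (n ∸ 2 ∸ (x + y) , z)

Special : ℕ × ℕ → Set
Special (a , b) =
  (a ≡ 0 × b ≡ 0) ⊎ (∃[ k ] (a ≡ 2 * k + 1 × (b ≡ k ⊎ b ≡ k + 1)))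

FormulaValue : ℕ → Pt → ℕ → Set
FormulaValue n p v = (Special (π n p) × v ≡ 1) ⊎ (¬ Special (π n p) × v ≡ 0)

-- The ideal Λ_y has maximum y, so Λ_p is the only member of OI with maximum p: a single coin at p has
-- exactly one option, g(p) is 1 or 0 according as the nim-sum of g over Λ_p ∖ {p} is 0 or not, and
-- induction along ≼ shows that g is unique. For the 0/1-valued candidate f(t) = [π t is special] this
-- recursion says that every principal ideal Λ_p contains an odd number of special points.
-- Write p = (x₀, y₀, z₀), A = n - 2 - x₀ - y₀ and t = (x₀ + i, y₀ + j, z). Membership of t in Λ_p and
-- the value π t = (A - i - j, z) depend on (i, j) only through i + j, so the contributions of (i, j) and
-- (j, i) cancel and only i = j remains, where π t = (A - 2i, z). If A is even, the only special point
-- met is (0, 0). If A = 2m + 1, level i meets the special points (2k + 1, k) and (2k + 1, k + 1) with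
-- i + k = m exactly when |m - z₀| ≤ i and |m + 1 - z₀| ≤ i respectively; these two distances are
-- consecutive numbers, so the two conditions differ for exactly one i.

module Submission where

open import Defs
open import Data.Nat using (ℕ; zero; suc; ⌊_/2⌋; _+_; _*_; _∸_; _≤_; _<_; _≤?_; _<?_; _≟_; s≤s; z<s)
open import Data.Nat.Properties
open import Data.Bool using (Bool; true; false; _∧_; _xor_; not; if_then_else_)
open import Data.Bool.Properties
  using (xor-assoc; xor-comm; xor-same; xor-identityʳ; ∧-zeroʳ; ∧-identityʳ; ∧-distribˡ-xor; ∧-comm; ∧-assoc; ∧-conicalˡ; ∧-conicalʳ)
open import Data.Product using (_×_; _,_; proj₂; ∃)
open import Data.Sum using (_⊎_; inj₁; inj₂)
open import Data.List using (List; []; _∷_; _++_; foldr; map; concatMap; filter; upTo)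
open import Data.List.Properties using (upTo-∷ʳ; foldr-fusion)
open import Data.List.Membership.Propositional using (_∈_)
open import Data.List.Membership.Propositional.Properties using (∈-filter⁻)
open import Data.List.Relation.Unary.Any using (here; there)
open import Relation.Unary using (Pred; Decidable)
open import Relation.Nullary using (¬_; Dec; yes; no; does; contradiction)
open import Relation.Nullary.Decidable using (dec-true; dec-false; does-⇔; _×-dec_; ¬?)
open import Function using (_∘_)
open import Function.Bundles using (mk⇔)
open import Data.Nat.Solver using (module +-*-Solver)
open +-*-Solver using (solve; _:+_; _:=_)
open import Relation.Binary.PropositionalEquality
open import Relation.Binary.Definitions using (tri<; tri≈; tri>)
open ≡-Reasoning

private variable X Y : Set

xor-interchange : ∀ p q r s → (p xor q) xor (r xor s) ≡ (p xor r) xor (q xor s)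
xor-interchange p q r s = begin
  (p xor q) xor (r xor s)  ≡⟨ xor-assoc p q (r xor s) ⟩
  p xor (q xor (r xor s))  ≡⟨ cong (p xor_) (trans (sym (xor-assoc q r s)) (cong (_xor s) (xor-comm q r))) ⟩
  p xor ((r xor q) xor s)  ≡⟨ cong (p xor_) (xor-assoc r q s) ⟩
  p xor (r xor (q xor s))  ≡⟨ sym (xor-assoc p r (q xor s)) ⟩
  (p xor r) xor (q xor s)  ∎

-- Parity sums

xorSum : ℕ → (ℕ → Bool) → Bool
xorSum zero    h = false
xorSum (suc K) h = xorSum K h xor h K

xorSum-cong : ∀ K {a b : ℕ → Bool} → (∀ i → i < K → a i ≡ b i) → xorSum K a ≡ xorSum K b
xorSum-cong zero    eq = refl
xorSum-cong (suc K) eq = cong₂ _xor_ (xorSum-cong K (λ i i<K → eq i (m<n⇒m<1+n i<K))) (eq K ≤-refl)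

xorSum-false : ∀ K {h : ℕ → Bool} → (∀ i → i < K → h i ≡ false) → xorSum K h ≡ false
xorSum-false zero    vanish = refl
xorSum-false (suc K) vanish = cong₂ _xor_ (xorSum-false K (λ i i<K → vanish i (m<n⇒m<1+n i<K))) (vanish K ≤-refl)

xorSum-xor : ∀ K (a b : ℕ → Bool) → xorSum K (λ i → a i xor b i) ≡ xorSum K a xor xorSum K b
xorSum-xor zero    a b = refl
xorSum-xor (suc K) a b = begin
  xorSum K (λ i → a i xor b i) xor (a K xor b K)  ≡⟨ cong (_xor (a K xor b K)) (xorSum-xor K a b) ⟩
  (xorSum K a xor xorSum K b) xor (a K xor b K)   ≡⟨ xor-interchange (xorSum K a) (xorSum K b) (a K) (b K) ⟩
  (xorSum K a xor a K) xor (xorSum K b xor b K)   ∎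

xorSum-∧ˡ : ∀ K b (h : ℕ → Bool) → xorSum K (λ i → b ∧ h i) ≡ b ∧ xorSum K h
xorSum-∧ˡ K true  h = refl
xorSum-∧ˡ K false h = xorSum-false K (λ _ _ → refl)

xorSum-+ : ∀ c K (h : ℕ → Bool) → xorSum (c + K) h ≡ xorSum c h xor xorSum K (λ i → h (c + i))
xorSum-+ c zero    h rewrite +-identityʳ c = sym (xor-identityʳ (xorSum c h))
xorSum-+ c (suc K) h rewrite +-suc c K = begin
  xorSum (c + K) h xor h (c + K)                                  ≡⟨ cong (_xor h (c + K)) (xorSum-+ c K h) ⟩
  (xorSum c h xor xorSum K (λ i → h (c + i))) xor h (c + K)       ≡⟨ xor-assoc (xorSum c h) _ _ ⟩
  xorSum c h xor (xorSum K (λ i → h (c + i)) xor h (c + K))       ∎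

xorSum-dropLower : ∀ c K {h : ℕ → Bool} → (∀ i → i < c → h i ≡ false) →
                   xorSum (c + K) h ≡ xorSum K (λ i → h (c + i))
xorSum-dropLower c K {h} vanish = begin
  xorSum (c + K) h                                  ≡⟨ xorSum-+ c K h ⟩
  xorSum c h xor xorSum K (λ i → h (c + i))         ≡⟨ cong (_xor xorSum K (λ i → h (c + i))) (xorSum-false c vanish) ⟩
  xorSum K (λ i → h (c + i))                        ∎

xorSum-truncate : ∀ {K K'} {h : ℕ → Bool} → K ≤ K' → (∀ i → K ≤ i → h i ≡ false) →
                  xorSum K' h ≡ xorSum K h
xorSum-truncate {K} {h = h} K≤K' vanish with m≤n⇒∃[o]m+o≡n K≤K'
... | e , refl = begin
  xorSum (K + e) h                                  ≡⟨ xorSum-+ K e h ⟩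
  xorSum K h xor xorSum e (λ i → h (K + i))         ≡⟨ cong (xorSum K h xor_) (xorSum-false e (λ i _ → vanish (K + i) (m≤m+n K i))) ⟩
  xorSum K h xor false                              ≡⟨ xor-identityʳ _ ⟩
  xorSum K h                                        ∎

xorSum-delta : ∀ {K c} (h : ℕ → Bool) → c < K → xorSum K (λ i → does (i ≟ c) ∧ h i) ≡ h c
xorSum-delta {suc K} {c} h c<1+K with m<1+n⇒m<n∨m≡n c<1+K
... | inj₁ c<K rewrite xorSum-delta h c<K | dec-false (K ≟ c) (λ K≡c → <-irrefl (sym K≡c) c<K) =
  xor-identityʳ (h c)
... | inj₂ refl rewrite dec-true (c ≟ c) refl =
  cong (_xor h c) (xorSum-false c (λ i i<c → cong (_∧ h i) (dec-false (i ≟ c) (<⇒≢ i<c))))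

xorSum-diagonal : ∀ K (G : ℕ → ℕ → Bool) → (∀ i j → G i j ≡ G j i) →
                  xorSum K (λ i → xorSum K (G i)) ≡ xorSum K (λ i → G i i)
xorSum-diagonal zero    G sym-G = refl
xorSum-diagonal (suc K) G sym-G = begin
  xorSum (suc K) (λ i → xorSum K (G i) xor G i K)
    ≡⟨ xorSum-xor (suc K) (λ i → xorSum K (G i)) (λ i → G i K) ⟩
  (xorSum K (λ i → xorSum K (G i)) xor xorSum K (G K)) xor (xorSum K (λ i → G i K) xor G K K)
    ≡⟨ cong (λ s → (xorSum K (λ i → xorSum K (G i)) xor xorSum K (G K)) xor (s xor G K K)) (xorSum-cong K (λ i _ → sym-G i K)) ⟩
  (xorSum K (λ i → xorSum K (G i)) xor xorSum K (G K)) xor (xorSum K (G K) xor G K K)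
    ≡⟨ xor-cancel-middle (xorSum K (λ i → xorSum K (G i))) (xorSum K (G K)) (G K K) ⟩
  xorSum K (λ i → xorSum K (G i)) xor G K K
    ≡⟨ cong (_xor G K K) (xorSum-diagonal K G sym-G) ⟩
  xorSum K (λ i → G i i) xor G K K
    ∎
  where
  xor-cancel-middle : ∀ p q r → (p xor q) xor (q xor r) ≡ p xor r
  xor-cancel-middle p q r = begin
    (p xor q) xor (q xor r)  ≡⟨ xor-assoc p q (q xor r) ⟩
    p xor (q xor (q xor r))  ≡⟨ cong (p xor_) (sym (xor-assoc q q r)) ⟩
    p xor ((q xor q) xor r)  ≡⟨ cong (λ s → p xor (s xor r)) (xor-same q) ⟩
    p xor r                  ∎

xorList : (X → Bool) → List X → Bool
xorList h = foldr (λ t b → h t xor b) false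

xorList-++ : ∀ (h : X → Bool) xs ys → xorList h (xs ++ ys) ≡ xorList h xs xor xorList h ys
xorList-++ h []       ys = refl
xorList-++ h (x ∷ xs) ys = trans (cong (h x xor_) (xorList-++ h xs ys)) (sym (xor-assoc (h x) _ _))

xorList-cong : ∀ {a b : X → Bool} → (∀ t → a t ≡ b t) → ∀ xs → xorList a xs ≡ xorList b xs
xorList-cong eq []       = refl
xorList-cong eq (x ∷ xs) = cong₂ _xor_ (eq x) (xorList-cong eq xs)

xorList-xor : ∀ (a b : X → Bool) xs → xorList (λ t → a t xor b t) xs ≡ xorList a xs xor xorList b xs
xorList-xor a b []       = refl
xorList-xor a b (x ∷ xs) = begin
  (a x xor b x) xor xorList (λ t → a t xor b t) xs     ≡⟨ cong ((a x xor b x) xor_) (xorList-xor a b xs) ⟩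
  (a x xor b x) xor (xorList a xs xor xorList b xs)    ≡⟨ xor-interchange (a x) (b x) (xorList a xs) (xorList b xs) ⟩
  (a x xor xorList a xs) xor (b x xor xorList b xs)    ∎

xorList-filter : ∀ {ℓ} {P : Pred X ℓ} (P? : Decidable P) (h : X → Bool) xs →
                 xorList h (filter P? xs) ≡ xorList (λ t → does (P? t) ∧ h t) xs
xorList-filter P? h []       = refl
xorList-filter P? h (x ∷ xs) with does (P? x)
... | true  = cong (h x xor_) (xorList-filter P? h xs)
... | false = xorList-filter P? h xs

xorList-concatMap : ∀ (h : Y → Bool) (f : X → List Y) xs →
                    xorList h (concatMap f xs) ≡ xorList (λ a → xorList h (f a)) xs
xorList-concatMap h f []       = refl
xorList-concatMap h f (x ∷ xs) =
  trans (xorList-++ h (f x) (concatMap f xs)) (cong (xorList h (f x) xor_) (xorList-concatMap h f xs))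

xorList-map : ∀ (h : Y → Bool) (f : X → Y) xs → xorList h (map f xs) ≡ xorList (λ a → h (f a)) xs
xorList-map h f []       = refl
xorList-map h f (x ∷ xs) = cong (h (f x) xor_) (xorList-map h f xs)

xorList-upTo : ∀ K (h : ℕ → Bool) → xorList h (upTo K) ≡ xorSum K h
xorList-upTo zero    h = refl
xorList-upTo (suc K) h = begin
  xorList h (upTo (suc K))              ≡⟨ cong (xorList h) (sym (upTo-∷ʳ K)) ⟩
  xorList h (upTo K ++ K ∷ [])          ≡⟨ xorList-++ h (upTo K) (K ∷ []) ⟩
  xorList h (upTo K) xor (h K xor false) ≡⟨ cong₂ _xor_ (xorList-upTo K h) (xor-identityʳ (h K)) ⟩
  xorSum K h xor h K                    ∎

xorSum³ : ℕ → (Pt → Bool) → Bool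
xorSum³ M w = xorSum M (λ x → xorSum M (λ y → xorSum M (λ z → w (x , y , z))))

box : ℕ → List Pt
box M = concatMap (λ x → concatMap (λ y → map (λ z → (x , y , z)) (upTo M)) (upTo M)) (upTo M)

xorList-box : ∀ M (w : Pt → Bool) → xorList w (box M) ≡ xorSum³ M w
xorList-box M w =
  trans (xorList-concatMap w _ (upTo M))
  (trans (xorList-cong (λ x → trans (xorList-concatMap w _ (upTo M))
                              (trans (xorList-cong (λ y → trans (xorList-map w _ (upTo M)) (xorList-upTo M _)) (upTo M))
                                     (xorList-upTo M _))) (upTo M))
         (xorList-upTo M _))

-- The special points

isOdd : ℕ → Bool
isOdd zero    = false
isOdd (suc n) = not (isOdd n)

isOdd-double : ∀ k → isOdd (k + k) ≡ false
isOdd-double zero    = refl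
isOdd-double (suc k) rewrite +-suc k k | isOdd-double k = refl

⌊suc-double/2⌋ : ∀ k → ⌊ suc (k + k) /2⌋ ≡ k
⌊suc-double/2⌋ zero    = refl
⌊suc-double/2⌋ (suc k) rewrite +-suc k k = cong suc (⌊suc-double/2⌋ k)

even-or-odd : ∀ a → ∃ λ k → a ≡ k + k ⊎ a ≡ suc (k + k)
even-or-odd zero = 0 , inj₁ refl
even-or-odd (suc a) with even-or-odd a
... | k , inj₁ refl = k , inj₂ refl
... | k , inj₂ refl = suc k , inj₁ (cong suc (sym (+-suc k k)))

special : ℕ × ℕ → Bool
special (a , z) =
  if isOdd a then does (z ≟ ⌊ a /2⌋) xor does (z ≟ suc ⌊ a /2⌋)
             else does (a ≟ 0) ∧ does (z ≟ 0)

special-even : ∀ k z → special (k + k , z) ≡ does (k ≟ 0) ∧ does (z ≟ 0)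
special-even k z rewrite isOdd-double k =
  cong (_∧ does (z ≟ 0)) (does-⇔ (mk⇔ (λ k+k≡0 → m+n≡0⇒m≡0 k k+k≡0) (λ { refl → refl })) (k + k ≟ 0) (k ≟ 0))

special-odd : ∀ k z → special (suc (k + k) , z) ≡ does (z ≟ k) xor does (z ≟ suc k)
special-odd k z rewrite isOdd-double k | ⌊suc-double/2⌋ k = refl

2k+1≡suc[k+k] : ∀ k → 2 * k + 1 ≡ suc (k + k)
2k+1≡suc[k+k] k rewrite +-identityʳ k = +-comm (k + k) 1

from-does : ∀ {P : Set} (P? : Dec P) → does P? ≡ true → P
from-does (yes p) _ = p

xor-true : ∀ x y → x xor y ≡ true → x ≡ true ⊎ y ≡ true
xor-true true  y _  = inj₁ refl
xor-true false y eq = inj₂ eq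

special⇒Special : ∀ a b → special (a , b) ≡ true → Special (a , b)
special⇒Special a b sp with even-or-odd a
... | k , inj₁ refl with from-does (k ≟ 0) (∧-conicalˡ _ _ sp′) | from-does (b ≟ 0) (∧-conicalʳ _ _ sp′)
  where sp′ = trans (sym (special-even k b)) sp
...   | refl | b≡0 = inj₁ (refl , b≡0)
special⇒Special a b sp | k , inj₂ refl with xor-true _ _ (trans (sym (special-odd k b)) sp)
...   | inj₁ b≡k   = inj₂ (k , sym (2k+1≡suc[k+k] k) , inj₁ (from-does (b ≟ k) b≡k))
...   | inj₂ b≡1+k = inj₂ (k , sym (2k+1≡suc[k+k] k) , inj₂ (trans (from-does (b ≟ suc k) b≡1+k) (+-comm 1 k)))

Special⇒special : ∀ a b → Special (a , b) → special (a , b) ≡ true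
Special⇒special .0 .0 (inj₁ (refl , refl)) = refl
Special⇒special .(2 * k + 1) b (inj₂ (k , refl , b≡)) rewrite 2k+1≡suc[k+k] k | special-odd k b with b≡
... | inj₁ refl rewrite dec-true (k ≟ k) refl | dec-false (k ≟ suc k) (1+n≢n ∘ sym) = refl
... | inj₂ refl rewrite +-comm k 1 | dec-false (suc k ≟ k) 1+n≢n | dec-true (suc k ≟ suc k) refl = refl

xorSum-special-even : ∀ K k (c : ℕ → Bool) → 0 < K →
                      xorSum K (λ z → c z ∧ special (k + k , z)) ≡ does (k ≟ 0) ∧ c 0
xorSum-special-even K k c 0<K = begin
  xorSum K (λ z → c z ∧ special (k + k , z))
    ≡⟨ xorSum-cong K (λ z _ → rearrange (c z) (does (k ≟ 0)) (does (z ≟ 0)) (special-even k z)) ⟩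
  xorSum K (λ z → does (z ≟ 0) ∧ does (k ≟ 0) ∧ c z)
    ≡⟨ xorSum-delta (λ z → does (k ≟ 0) ∧ c z) 0<K ⟩
  does (k ≟ 0) ∧ c 0
    ∎
  where
  rearrange : ∀ {s} x y z → s ≡ y ∧ z → x ∧ s ≡ z ∧ y ∧ x
  rearrange x y z refl = trans (∧-comm x (y ∧ z)) (trans (cong (_∧ x) (∧-comm y z)) (∧-assoc z y x))

xorSum-special-odd : ∀ K k (c : ℕ → Bool) → suc k < K →
                     xorSum K (λ z → c z ∧ special (suc (k + k) , z)) ≡ c k xor c (suc k)
xorSum-special-odd K k c 1+k<K = begin
  xorSum K (λ z → c z ∧ special (suc (k + k) , z))
    ≡⟨ xorSum-cong K (λ z _ → split (c z) (does (z ≟ k)) (does (z ≟ suc k)) (special-odd k z)) ⟩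
  xorSum K (λ z → does (z ≟ k) ∧ c z xor does (z ≟ suc k) ∧ c z)
    ≡⟨ xorSum-xor K (λ z → does (z ≟ k) ∧ c z) (λ z → does (z ≟ suc k) ∧ c z) ⟩
  xorSum K (λ z → does (z ≟ k) ∧ c z) xor xorSum K (λ z → does (z ≟ suc k) ∧ c z)
    ≡⟨ cong₂ _xor_ (xorSum-delta c (<-trans (n<1+n k) 1+k<K)) (xorSum-delta c 1+k<K) ⟩
  c k xor c (suc k)
    ∎
  where
  split : ∀ {s} x p q → s ≡ p xor q → x ∧ s ≡ p ∧ x xor q ∧ x
  split x p q refl = trans (∧-distribˡ-xor x p q) (cong₂ _xor_ (∧-comm x p) (∧-comm x q))

-- For p = (x₀, y₀, z₀) ∈ ASM with n ∸ 2 = x₀ + y₀ + A, the point t = (x₀ + i, y₀ + j, z) lies in Λ_p iff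
-- inWindow A z₀ (i + j) z, and then π t = (A ∸ (i + j), z); see specialIn-shifted.
inWindow : ℕ → ℕ → ℕ → ℕ → Bool
inWindow A z₀ u z = does (u + z ≤? A) ∧ does (z ≤? z₀) ∧ does (z₀ ≤? u + z)

levelSum : ℕ → ℕ → ℕ → Bool
levelSum A z₀ u = xorSum (suc A) (λ z → inWindow A z₀ u z ∧ special (A ∸ u , z))

inWindow-beyond : ∀ A z₀ u z → A < u + z → inWindow A z₀ u z ≡ false
inWindow-beyond A z₀ u z A<u+z rewrite dec-false (u + z ≤? A) (<⇒≱ A<u+z) = refl

levelSum-beyond : ∀ {A u} z₀ → A < u → levelSum A z₀ u ≡ false
levelSum-beyond {A} {u} z₀ A<u = xorSum-false (suc A) vanish
  where
  vanish : ∀ z → z < suc A → inWindow A z₀ u z ∧ special (A ∸ u , z) ≡ false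
  vanish z _ = cong (_∧ special (A ∸ u , z)) (inWindow-beyond A z₀ u z (<-≤-trans A<u (m≤m+n u z)))

[i+k]+[i+k]≡[i+i]+[k+k] : ∀ i k → (i + k) + (i + k) ≡ (i + i) + (k + k)
[i+k]+[i+k]≡[i+i]+[k+k] = solve 2 (λ i k → (i :+ k) :+ (i :+ k) := (i :+ i) :+ (k :+ k)) refl

levelSum-even : ∀ i k z₀ → z₀ ≤ (i + k) + (i + k) → levelSum ((i + k) + (i + k)) z₀ (i + i) ≡ does (k ≟ 0)
levelSum-even i k z₀ z₀≤A = begin
  xorSum (suc A) (λ z → inWindow A z₀ (i + i) z ∧ special (A ∸ (i + i) , z))
    ≡⟨ cong (λ a → xorSum (suc A) (λ z → inWindow A z₀ (i + i) z ∧ special (a , z))) A∸[i+i]≡k+k ⟩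
  xorSum (suc A) (λ z → inWindow A z₀ (i + i) z ∧ special (k + k , z))
    ≡⟨ xorSum-special-even (suc A) k (inWindow A z₀ (i + i)) z<s ⟩
  does (k ≟ 0) ∧ inWindow A z₀ (i + i) 0
    ≡⟨ bottom-inWindow k (k ≟ 0) z₀≤A ⟩
  does (k ≟ 0)
    ∎
  where
  A = (i + k) + (i + k)
  A∸[i+i]≡k+k : A ∸ (i + i) ≡ k + k
  A∸[i+i]≡k+k = trans (cong (_∸ (i + i)) ([i+k]+[i+k]≡[i+i]+[k+k] i k)) (m+n∸m≡n (i + i) (k + k))
  bottom-inWindow : ∀ k (k≟0 : Dec (k ≡ 0)) → z₀ ≤ (i + k) + (i + k) →
                    does k≟0 ∧ inWindow ((i + k) + (i + k)) z₀ (i + i) 0 ≡ does k≟0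
  bottom-inWindow k (no _)     _    = refl
  bottom-inWindow _ (yes refl) z₀≤A rewrite +-identityʳ i | +-identityʳ (i + i)
    | dec-true (i + i ≤? i + i) ≤-refl | dec-true (z₀ ≤? i + i) z₀≤A = refl

near : ℕ → ℕ → ℕ → Bool
near c z₀ i = does (c ≤? z₀ + i) ∧ does (z₀ ≤? c + i)

does-+-cancelˡ-≤ : ∀ m a b → does (m + a ≤? m + b) ≡ does (a ≤? b)
does-+-cancelˡ-≤ m a b = does-⇔ (mk⇔ (+-cancelˡ-≤ m a b) (+-monoʳ-≤ m)) (m + a ≤? m + b) (a ≤? b)

near-above : ∀ z₀ d i → near (z₀ + d) z₀ i ≡ does (d ≤? i)
near-above z₀ d i rewrite does-+-cancelˡ-≤ z₀ d i | +-assoc z₀ d i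
  | dec-true (z₀ ≤? z₀ + (d + i)) (m≤m+n z₀ (d + i)) = ∧-identityʳ _

near-below : ∀ c e i → near c (c + e) i ≡ does (e ≤? i)
near-below c e i rewrite +-assoc c e i | dec-true (c ≤? c + (e + i)) (m≤m+n c (e + i))
  = does-+-cancelˡ-≤ c e i

≤-xor-< : ∀ d i → does (d ≤? i) xor does (d <? i) ≡ does (i ≟ d)
≤-xor-< d i with <-cmp i d
... | tri< i<d _ _ rewrite dec-false (d ≤? i) (<⇒≱ i<d) | dec-false (d <? i) (<⇒≯ i<d)
  | dec-false (i ≟ d) (<⇒≢ i<d) = refl
... | tri≈ _ refl _ rewrite dec-true (d ≤? d) ≤-refl | dec-false (d <? d) (<-irrefl refl)
  | dec-true (d ≟ d) refl = refl
... | tri> _ _ d<i rewrite dec-true (d ≤? i) (<⇒≤ d<i) | dec-true (d <? i) d<i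
  | dec-false (i ≟ d) (<⇒≢ d<i ∘ sym) = refl

near-adjacent : ∀ m z₀ → z₀ ≤ suc (m + m) →
                ∃ λ d → d < suc m × (∀ i → near m z₀ i xor near (suc m) z₀ i ≡ does (i ≟ d))
near-adjacent m z₀ z₀≤2m+1 with z₀ ≤? m
... | yes z₀≤m with m≤n⇒∃[o]m+o≡n z₀≤m
...   | d , refl = d , s≤s (m≤n+m d z₀) , λ i → begin
  near (z₀ + d) z₀ i xor near (suc (z₀ + d)) z₀ i
    ≡⟨ cong₂ _xor_ (near-above z₀ d i) (trans (cong (λ c → near c z₀ i) (sym (+-suc z₀ d))) (near-above z₀ (suc d) i)) ⟩
  does (d ≤? i) xor does (d <? i)
    ≡⟨ ≤-xor-< d i ⟩
  does (i ≟ d)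
    ∎
near-adjacent m z₀ z₀≤2m+1 | no z₀≰m with m≤n⇒∃[o]m+o≡n (≰⇒> z₀≰m)
... | e , refl = e , s≤s (+-cancelˡ-≤ (suc m) e m z₀≤2m+1) , λ i → begin
  near m (suc m + e) i xor near (suc m) (suc m + e) i
    ≡⟨ cong₂ _xor_ (trans (cong (λ z → near m z i) (sym (+-suc m e))) (near-below m (suc e) i)) (near-below (suc m) e i) ⟩
  does (e <? i) xor does (e ≤? i)
    ≡⟨ xor-comm (does (e <? i)) (does (e ≤? i)) ⟩
  does (e ≤? i) xor does (e <? i)
    ≡⟨ ≤-xor-< e i ⟩
  does (i ≟ e)
    ∎

inWindow-near : ∀ A i k z₀ → i + i + k ≤ A → inWindow A z₀ (i + i) k ≡ near (i + k) z₀ i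
inWindow-near A i k z₀ le rewrite dec-true (i + i + k ≤? A) le = cong₂ _∧_
  (does-⇔ (mk⇔ (λ k≤z₀ → subst (i + k ≤_) (+-comm i z₀) (+-monoʳ-≤ i k≤z₀))
               (λ le′ → +-cancelˡ-≤ i k z₀ (subst (i + k ≤_) (+-comm z₀ i) le′)))
          (k ≤? z₀) (i + k ≤? z₀ + i))
  (cong (λ w → does (z₀ ≤? w)) (solve 2 (λ i k → i :+ i :+ k := i :+ k :+ i) refl i k))

levelSum-odd : ∀ i k z₀ →
               levelSum (suc ((i + k) + (i + k))) z₀ (i + i) ≡ near (i + k) z₀ i xor near (suc (i + k)) z₀ i
levelSum-odd i k z₀ = begin
  xorSum (suc A) (λ z → inWindow A z₀ (i + i) z ∧ special (A ∸ (i + i) , z))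
    ≡⟨ cong (λ a → xorSum (suc A) (λ z → inWindow A z₀ (i + i) z ∧ special (a , z))) A∸[i+i]≡1+k+k ⟩
  xorSum (suc A) (λ z → inWindow A z₀ (i + i) z ∧ special (suc (k + k) , z))
    ≡⟨ xorSum-special-odd (suc A) k (inWindow A z₀ (i + i)) (s≤s (s≤s (≤-trans (m≤n+m k i) (m≤m+n (i + k) (i + k))))) ⟩
  inWindow A z₀ (i + i) k xor inWindow A z₀ (i + i) (suc k)
    ≡⟨ cong₂ _xor_ (inWindow-near A i k z₀ (m≤n⇒m≤1+n lower≤))
                   (trans (inWindow-near A i (suc k) z₀ (≤-trans (≤-reflexive (+-suc (i + i) k)) (s≤s lower≤)))
                          (cong (λ c → near c z₀ i) (+-suc i k))) ⟩
  near (i + k) z₀ i xor near (suc (i + k)) z₀ i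
    ∎
  where
  A = suc ((i + k) + (i + k))
  A∸[i+i]≡1+k+k : A ∸ (i + i) ≡ suc (k + k)
  A∸[i+i]≡1+k+k = trans (cong (λ a → suc a ∸ (i + i)) ([i+k]+[i+k]≡[i+i]+[k+k] i k))
                        (trans (cong (_∸ (i + i)) (sym (+-suc (i + i) (k + k)))) (m+n∸m≡n (i + i) (suc (k + k))))
  lower≤ : i + i + k ≤ (i + k) + (i + k)
  lower≤ = ≤-trans (m≤m+n (i + i + k) k) (≤-reflexive (solve 2 (λ i k → i :+ i :+ k :+ k := (i :+ k) :+ (i :+ k)) refl i k))

diagonal-beyond : ∀ A m z₀ → m ≤ A → A < suc m + suc m →
                  xorSum (suc A) (λ i → levelSum A z₀ (i + i)) ≡ xorSum (suc m) (λ i → levelSum A z₀ (i + i))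
diagonal-beyond A m z₀ m≤A A<2m+2 = xorSum-truncate (s≤s m≤A)
  (λ i m<i → levelSum-beyond z₀ (<-≤-trans A<2m+2 (+-mono-≤ m<i m<i)))

diagonal-parity-even : ∀ m z₀ → z₀ ≤ m + m → xorSum (suc (m + m)) (λ i → levelSum (m + m) z₀ (i + i)) ≡ true
diagonal-parity-even m z₀ z₀≤A = begin
  xorSum (suc (m + m)) (λ i → levelSum (m + m) z₀ (i + i))
    ≡⟨ diagonal-beyond (m + m) m z₀ (m≤m+n m m) (s≤s (+-monoʳ-≤ m (n≤1+n m))) ⟩
  xorSum (suc m) (λ i → levelSum (m + m) z₀ (i + i))
    ≡⟨ xorSum-cong (suc m) level ⟩
  xorSum (suc m) (λ i → does (i ≟ m) ∧ true)
    ≡⟨ xorSum-delta {c = m} (λ _ → true) ≤-refl ⟩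
  true
    ∎
  where
  level : ∀ i → i < suc m → levelSum (m + m) z₀ (i + i) ≡ does (i ≟ m) ∧ true
  level i i<1+m with m≤n⇒∃[o]m+o≡n (≤-pred i<1+m)
  ... | k , refl = trans (levelSum-even i k z₀ z₀≤A) (trans k≟0≡i≟i+k (sym (∧-identityʳ _)))
    where
    k≟0≡i≟i+k : does (k ≟ 0) ≡ does (i ≟ i + k)
    k≟0≡i≟i+k = does-⇔ (mk⇔ (λ { refl → sym (+-identityʳ i) })
                            (λ i≡i+k → +-cancelˡ-≡ i k 0 (trans (sym i≡i+k) (sym (+-identityʳ i)))))
                       (k ≟ 0) (i ≟ i + k)

diagonal-parity-odd : ∀ m z₀ → z₀ ≤ suc (m + m) →
                      xorSum (suc (suc (m + m))) (λ i → levelSum (suc (m + m)) z₀ (i + i)) ≡ true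
diagonal-parity-odd m z₀ z₀≤A with near-adjacent m z₀ z₀≤A
... | d , d<1+m , adjacent = begin
  xorSum (suc (suc (m + m))) (λ i → levelSum (suc (m + m)) z₀ (i + i))
    ≡⟨ diagonal-beyond (suc (m + m)) m z₀ (m≤n⇒m≤1+n (m≤m+n m m)) (s≤s (≤-reflexive (sym (+-suc m m)))) ⟩
  xorSum (suc m) (λ i → levelSum (suc (m + m)) z₀ (i + i))
    ≡⟨ xorSum-cong (suc m) level ⟩
  xorSum (suc m) (λ i → does (i ≟ d) ∧ true)
    ≡⟨ xorSum-delta {c = d} (λ _ → true) d<1+m ⟩
  true
    ∎
  where
  level : ∀ i → i < suc m → levelSum (suc (m + m)) z₀ (i + i) ≡ does (i ≟ d) ∧ true
  level i i<1+m with m≤n⇒∃[o]m+o≡n (≤-pred i<1+m)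
  ... | k , refl = trans (levelSum-odd i k z₀) (trans (adjacent i) (sym (∧-identityʳ _)))

diagonal-parity : ∀ A z₀ → z₀ ≤ A → xorSum (suc A) (λ i → levelSum A z₀ (i + i)) ≡ true
diagonal-parity A z₀ z₀≤A with even-or-odd A
... | m , inj₁ refl = diagonal-parity-even m z₀ z₀≤A
... | m , inj₂ refl = diagonal-parity-odd m z₀ z₀≤A

-- Special points of a principal ideal

specialIn : ℕ → Pt → Pt → Bool
specialIn N p (x , y , z) = does (x + y + z ≤? N) ∧ does ((x , y , z) ≼? p) ∧ special (N ∸ (x + y) , z)

specialIn-shifted : ∀ x₀ y₀ z₀ A i j z →
  specialIn (x₀ + y₀ + A) (x₀ , y₀ , z₀) (x₀ + i , y₀ + j , z) ≡ inWindow A z₀ (i + j) z ∧ special (A ∸ (i + j) , z)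
specialIn-shifted x₀ y₀ z₀ A i j z
  rewrite solve 4 (λ x₀ y₀ i j → x₀ :+ i :+ (y₀ :+ j) := x₀ :+ y₀ :+ (i :+ j)) refl x₀ y₀ i j
        | +-assoc (x₀ + y₀) (i + j) z
        | does-+-cancelˡ-≤ (x₀ + y₀) (i + j + z) A | does-+-cancelˡ-≤ (x₀ + y₀) z₀ (i + j + z)
        | [m+n]∸[m+o]≡n∸o (x₀ + y₀) A (i + j)
        | dec-true (x₀ ≤? x₀ + i) (m≤m+n x₀ i) | dec-true (y₀ ≤? y₀ + j) (m≤m+n y₀ j)
  = sym (∧-assoc a (b ∧ c) s)
  where
  a = does (i + j + z ≤? A)
  b = does (z ≤? z₀)
  c = does (z₀ ≤? i + j + z)
  s = special (A ∸ (i + j) , z)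

specialIn-levels : ∀ x₀ y₀ z₀ A →
  xorSum³ (suc (x₀ + y₀ + A)) (specialIn (x₀ + y₀ + A) (x₀ , y₀ , z₀))
  ≡ xorSum (suc (y₀ + A)) (λ i → xorSum (suc (x₀ + A)) (λ j → levelSum A z₀ (i + j)))
specialIn-levels x₀ y₀ z₀ A = begin
  xorSum M (λ x → xorSum M (λ y → xorSum M (λ z → specialIn N p (x , y , z))))
    ≡⟨ cong (λ K → xorSum K sliceX) M≡x₀+[1+y₀+A] ⟩
  xorSum (x₀ + suc (y₀ + A)) sliceX
    ≡⟨ xorSum-dropLower x₀ (suc (y₀ + A)) (λ x x<x₀ → xorSum-false M (λ y _ → xorSum-false M (λ z _ → below-x x y z x<x₀))) ⟩
  xorSum (suc (y₀ + A)) (λ i → xorSum M (λ y → xorSum M (λ z → specialIn N p (x₀ + i , y , z))))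
    ≡⟨ xorSum-cong (suc (y₀ + A)) (λ i _ → trans (cong (λ K → xorSum K (sliceXY (x₀ + i))) M≡y₀+[1+x₀+A])
         (xorSum-dropLower y₀ (suc (x₀ + A)) (λ y y<y₀ → xorSum-false M (λ z _ → below-y (x₀ + i) y z y<y₀)))) ⟩
  xorSum (suc (y₀ + A)) (λ i → xorSum (suc (x₀ + A)) (λ j → xorSum M (λ z → specialIn N p (x₀ + i , y₀ + j , z))))
    ≡⟨ xorSum-cong (suc (y₀ + A)) (λ i _ → xorSum-cong (suc (x₀ + A)) (λ j _ → level i j)) ⟩
  xorSum (suc (y₀ + A)) (λ i → xorSum (suc (x₀ + A)) (λ j → levelSum A z₀ (i + j)))
    ∎
  where
  N = x₀ + y₀ + A
  M = suc N
  p = (x₀ , y₀ , z₀)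
  M≡x₀+[1+y₀+A] : M ≡ x₀ + suc (y₀ + A)
  M≡x₀+[1+y₀+A] = sym (trans (+-suc x₀ (y₀ + A)) (cong suc (sym (+-assoc x₀ y₀ A))))
  M≡y₀+[1+x₀+A] : M ≡ y₀ + suc (x₀ + A)
  M≡y₀+[1+x₀+A] = trans (cong suc (solve 3 (λ x₀ y₀ A → x₀ :+ y₀ :+ A := y₀ :+ (x₀ :+ A)) refl x₀ y₀ A))
                        (sym (+-suc y₀ (x₀ + A)))
  sliceXY : ℕ → ℕ → Bool
  sliceXY x y = xorSum M (λ z → specialIn N p (x , y , z))
  sliceX : ℕ → Bool
  sliceX x = xorSum M (sliceXY x)
  below-x : ∀ x y z → x < x₀ → specialIn N p (x , y , z) ≡ false
  below-x x y z x<x₀ rewrite dec-false (x₀ ≤? x) (<⇒≱ x<x₀) = ∧-zeroʳ _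
  below-y : ∀ x y z → y < y₀ → specialIn N p (x , y , z) ≡ false
  below-y x y z y<y₀ rewrite dec-false (y₀ ≤? y) (<⇒≱ y<y₀) | ∧-zeroʳ (does (x₀ ≤? x)) = ∧-zeroʳ _
  level : ∀ i j → xorSum M (λ z → specialIn N p (x₀ + i , y₀ + j , z)) ≡ levelSum A z₀ (i + j)
  level i j = trans (xorSum-cong M (λ z _ → specialIn-shifted x₀ y₀ z₀ A i j z))
    (xorSum-truncate (s≤s (m≤n+m A (x₀ + y₀)))
      (λ z A<z → cong (_∧ special (A ∸ (i + j) , z)) (inWindow-beyond A z₀ (i + j) z (<-≤-trans A<z (m≤n+m z (i + j))))))

specialIn-parity : ∀ N x₀ y₀ z₀ → x₀ + y₀ + z₀ ≤ N → xorSum³ (suc N) (specialIn N (x₀ , y₀ , z₀)) ≡ true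
specialIn-parity N x₀ y₀ z₀ p∈ASM with m≤n⇒∃[o]m+o≡n (≤-trans (m≤m+n (x₀ + y₀) z₀) p∈ASM)
... | A , refl = begin
  xorSum³ (suc N) (specialIn N (x₀ , y₀ , z₀))
    ≡⟨ specialIn-levels x₀ y₀ z₀ A ⟩
  xorSum (suc (y₀ + A)) (λ i → xorSum (suc (x₀ + A)) (λ j → levelSum A z₀ (i + j)))
    ≡⟨ xorSum-truncate (s≤s (m≤n+m A y₀))
         (λ i A<i → xorSum-false (suc (x₀ + A)) (λ j _ → levelSum-beyond z₀ (<-≤-trans A<i (m≤m+n i j)))) ⟩
  xorSum (suc A) (λ i → xorSum (suc (x₀ + A)) (λ j → levelSum A z₀ (i + j)))
    ≡⟨ xorSum-cong (suc A) (λ i _ → xorSum-truncate (s≤s (m≤n+m A x₀))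
         (λ j A<j → levelSum-beyond z₀ (<-≤-trans A<j (m≤n+m j i)))) ⟩
  xorSum (suc A) (λ i → xorSum (suc A) (λ j → levelSum A z₀ (i + j)))
    ≡⟨ xorSum-diagonal (suc A) (λ i j → levelSum A z₀ (i + j)) (λ i j → cong (levelSum A z₀) (+-comm i j)) ⟩
  xorSum (suc A) (λ i → levelSum A z₀ (i + i))
    ≡⟨ diagonal-parity A z₀ (+-cancelˡ-≤ (x₀ + y₀) z₀ A p∈ASM) ⟩
  true
    ∎

≟Pt-componentwise : ∀ x y z x₀ y₀ z₀ →
  does ((x , y , z) ≟Pt (x₀ , y₀ , z₀)) ≡ does (x ≟ x₀) ∧ does (y ≟ y₀) ∧ does (z ≟ z₀)
≟Pt-componentwise x y z x₀ y₀ z₀ =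
  does-⇔ (mk⇔ (λ { refl → refl , refl , refl }) (λ { (refl , refl , refl) → refl }))
         ((x , y , z) ≟Pt (x₀ , y₀ , z₀)) ((x ≟ x₀) ×-dec (y ≟ y₀) ×-dec (z ≟ z₀))

xorSum³-delta : ∀ M (w : Pt → Bool) x₀ y₀ z₀ → x₀ < M → y₀ < M → z₀ < M →
                xorSum³ M (λ t → does (t ≟Pt (x₀ , y₀ , z₀)) ∧ w t) ≡ w (x₀ , y₀ , z₀)
xorSum³-delta M w x₀ y₀ z₀ x₀<M y₀<M z₀<M = begin
  xorSum M (λ x → xorSum M (λ y → xorSum M (λ z → does ((x , y , z) ≟Pt (x₀ , y₀ , z₀)) ∧ w (x , y , z))))
    ≡⟨ xorSum-cong M (λ x _ → xorSum-cong M (λ y _ → fiber x y)) ⟩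
  xorSum M (λ x → xorSum M (λ y → does (x ≟ x₀) ∧ does (y ≟ y₀) ∧ w (x , y , z₀)))
    ≡⟨ xorSum-cong M (λ x _ → xorSum-∧ˡ M (does (x ≟ x₀)) (λ y → does (y ≟ y₀) ∧ w (x , y , z₀))) ⟩
  xorSum M (λ x → does (x ≟ x₀) ∧ xorSum M (λ y → does (y ≟ y₀) ∧ w (x , y , z₀)))
    ≡⟨ xorSum-delta (λ x → xorSum M (λ y → does (y ≟ y₀) ∧ w (x , y , z₀))) x₀<M ⟩
  xorSum M (λ y → does (y ≟ y₀) ∧ w (x₀ , y , z₀))
    ≡⟨ xorSum-delta (λ y → w (x₀ , y , z₀)) y₀<M ⟩
  w (x₀ , y₀ , z₀)
    ∎
  where
  fiber : ∀ x y → xorSum M (λ z → does ((x , y , z) ≟Pt (x₀ , y₀ , z₀)) ∧ w (x , y , z))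
                  ≡ does (x ≟ x₀) ∧ does (y ≟ y₀) ∧ w (x , y , z₀)
  fiber x y = begin
    xorSum M (λ z → does ((x , y , z) ≟Pt (x₀ , y₀ , z₀)) ∧ w (x , y , z))
      ≡⟨ xorSum-cong M (λ z _ → trans (cong (_∧ w (x , y , z)) (≟Pt-componentwise x y z x₀ y₀ z₀))
                                      (trans (∧-assoc dx (dy ∧ does (z ≟ z₀)) _) (cong (dx ∧_) (∧-assoc dy _ _)))) ⟩
    xorSum M (λ z → dx ∧ dy ∧ does (z ≟ z₀) ∧ w (x , y , z))
      ≡⟨ xorSum-∧ˡ M dx _ ⟩
    dx ∧ xorSum M (λ z → dy ∧ does (z ≟ z₀) ∧ w (x , y , z))
      ≡⟨ cong (dx ∧_) (trans (xorSum-∧ˡ M dy _) (cong (dy ∧_) (xorSum-delta (λ z → w (x , y , z)) z₀<M))) ⟩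
    dx ∧ dy ∧ w (x , y , z₀)
      ∎
    where
    dx = does (x ≟ x₀)
    dy = does (y ≟ y₀)

≼-refl : ∀ p → p ≼ p
≼-refl _ = ≤-refl , ≤-refl , ≤-refl , ≤-refl

bit : Bool → ℕ
bit false = 0
bit true  = 1

bit-xor : ∀ a b → bit (a xor b) ≡ bit a ⊕ bit b
bit-xor false false = refl
bit-xor false true  = refl
bit-xor true  false = refl
bit-xor true  true  = refl

grundyFormula : ℕ → Pt → ℕ
grundyFormula n t = bit (special (π n t))

InASM? : ∀ n → Decidable (InASM n)
InASM? n (x , y , z) = x + y + z ≤? n ∸ 2

Λ∖? : (y p : Pt) → Decidable (λ t → t ≼ y × ¬ t ≡ p)
Λ∖? y p t = (t ≼? y) ×-dec ¬? (t ≟Pt p)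

xorOver-bit : ∀ n (w : Pt → Bool) y p →
  xorOver n (λ t → bit (w t)) y p
  ≡ bit (xorList (λ t → does (InASM? n t) ∧ does (Λ∖? y p t) ∧ w t) (box (suc (n ∸ 2))))
xorOver-bit n w y p = begin
  xorOver n (λ t → bit (w t)) y p
    ≡⟨ sym (foldr-fusion bit {f = λ t b → w t xor b} false (λ t b → bit-xor (w t) b) (filter (Λ∖? y p) (asmList n))) ⟩
  bit (xorList w (filter (Λ∖? y p) (asmList n)))
    ≡⟨ cong bit (trans (xorList-filter (Λ∖? y p) w (asmList n))
                       (xorList-filter (InASM? n) (λ t → does (Λ∖? y p t) ∧ w t) (box (suc (n ∸ 2))))) ⟩
  bit (xorList (λ t → does (InASM? n t) ∧ does (Λ∖? y p t) ∧ w t) (box (suc (n ∸ 2))))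
    ∎

xorOver-grundyFormula : ∀ n x₀ y₀ z₀ → InASM n (x₀ , y₀ , z₀) →
  xorOver n (grundyFormula n) (x₀ , y₀ , z₀) (x₀ , y₀ , z₀) ≡ bit (not (special (π n (x₀ , y₀ , z₀))))
xorOver-grundyFormula n x₀ y₀ z₀ p∈ASM = begin
  xorOver n (grundyFormula n) p p
    ≡⟨ xorOver-bit n (λ t → special (π n t)) p p ⟩
  bit (xorList (λ t → does (InASM? n t) ∧ does (Λ∖? p p t) ∧ special (π n t)) (box (suc N)))
    ≡⟨ cong bit (xorList-cong split-off-p (box (suc N))) ⟩
  bit (xorList (λ t → specialIn N p t xor atP t) (box (suc N)))
    ≡⟨ cong bit (xorList-xor (specialIn N p) atP (box (suc N))) ⟩
  bit (xorList (specialIn N p) (box (suc N)) xor xorList atP (box (suc N)))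
    ≡⟨ cong bit (cong₂ _xor_ (xorList-box (suc N) (specialIn N p)) (xorList-box (suc N) atP)) ⟩
  bit (xorSum³ (suc N) (specialIn N p) xor xorSum³ (suc N) atP)
    ≡⟨ cong bit (cong₂ _xor_ (specialIn-parity N x₀ y₀ z₀ p∈ASM)
                              (xorSum³-delta (suc N) (specialIn N p) x₀ y₀ z₀ (s≤s x₀≤N) (s≤s y₀≤N) (s≤s z₀≤N))) ⟩
  bit (not (specialIn N p p))
    ≡⟨ cong (λ b → bit (not b)) specialIn-self ⟩
  bit (not (special (π n p)))
    ∎
  where
  N = n ∸ 2
  p = (x₀ , y₀ , z₀)
  atP : Pt → Bool
  atP t = does (t ≟Pt p) ∧ specialIn N p t
  split-off-p : ∀ t → does (InASM? n t) ∧ does (Λ∖? p p t) ∧ special (π n t)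
                      ≡ specialIn N p t xor atP t
  split-off-p t@(x , y , z) with does (t ≟Pt p)
  ... | false rewrite ∧-identityʳ (does (t ≼? p)) = sym (xor-identityʳ (specialIn N p t))
  ... | true  rewrite ∧-zeroʳ (does (t ≼? p)) | ∧-zeroʳ (does (InASM? n t)) = sym (xor-same (specialIn N p t))
  x₀≤N : x₀ ≤ N
  x₀≤N = ≤-trans (≤-trans (m≤m+n x₀ y₀) (m≤m+n (x₀ + y₀) z₀)) p∈ASM
  y₀≤N : y₀ ≤ N
  y₀≤N = ≤-trans (≤-trans (m≤n+m y₀ x₀) (m≤m+n (x₀ + y₀) z₀)) p∈ASM
  z₀≤N : z₀ ≤ N
  z₀≤N = ≤-trans (m≤n+m z₀ (x₀ + y₀)) p∈ASM
  specialIn-self : specialIn N p p ≡ special (π n p)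
  specialIn-self rewrite dec-true (x₀ + y₀ + z₀ ≤? N) p∈ASM | dec-true (p ≼? p) (≼-refl p) = refl

-- The game

mex₁ : ℕ → ℕ
mex₁ zero    = 1
mex₁ (suc _) = 0

IsMex-unique : ∀ {S : ℕ → Set} {m m′} → IsMex S m → IsMex S m′ → m ≡ m′
IsMex-unique {m = m} {m′} (m∉S , below-m) (m′∉S , below-m′) with <-cmp m m′
... | tri< m<m′ _ _ = contradiction (below-m′ m m<m′) m∉S
... | tri≈ _ m≡m′ _ = m≡m′
... | tri> _ _ m′<m = contradiction (below-m m′ m′<m) m′∉S

IsMex-singleton : ∀ {S : ℕ → Set} c → (∀ v → S v → v ≡ c) → S c → IsMex S (mex₁ c)
IsMex-singleton zero    only-c c∈S = (λ 1∈S → 1+n≢0 (only-c 1 1∈S)) , λ { zero _ → c∈S ; (suc _) (s≤s ()) }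
IsMex-singleton (suc c) only-c c∈S = (λ 0∈S → 0≢1+n (only-c 0 0∈S)) , λ _ ()

mex₁-bit-not : ∀ b → mex₁ (bit (not b)) ≡ bit b
mex₁-bit-not false = refl
mex₁-bit-not true  = refl

≼-antisym : ∀ {p q} → p ≼ q → q ≼ p → p ≡ q
≼-antisym {_ , _ , _} {_ , _ , _} (x₀≤x , y₀≤y , z≤z₀ , _) (x≤x₀ , y≤y₀ , z₀≤z , _)
  rewrite ≤-antisym x≤x₀ x₀≤x | ≤-antisym y≤y₀ y₀≤y | ≤-antisym z≤z₀ z₀≤z = refl

-- Λ_y has maximum p only if y = p.
optionValue-unique : ∀ {n g p v} → OptionValue n g p v → v ≡ xorOver n g p p
optionValue-unique {p = p} (y , y∈ASM , ((_ , p≼y) , below-p) , refl)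
  rewrite ≼-antisym (below-p y (y∈ASM , ≼-refl y)) p≼y = refl

optionValue-self : ∀ {n g p} → InASM n p → OptionValue n g p (xorOver n g p p)
optionValue-self {p = p} p∈ASM = p , p∈ASM , ((p∈ASM , ≼-refl p) , λ _ t∈Λ → proj₂ t∈Λ) , refl

grundy-mex : ∀ {n g p} → IsGrundy n g → InASM n p → g p ≡ mex₁ (xorOver n g p p)
grundy-mex {n} {g} {p} grundy p∈ASM =
  IsMex-unique (grundy p p∈ASM) (IsMex-singleton _ (λ _ → optionValue-unique {n} {g}) (optionValue-self {n} {g} p∈ASM))

grundyFormula-isGrundy : ∀ n → IsGrundy n (grundyFormula n)
grundyFormula-isGrundy n p@(x₀ , y₀ , z₀) p∈ASM =
  subst (IsMex (OptionValue n (grundyFormula n) p))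
        (trans (cong mex₁ (xorOver-grundyFormula n x₀ y₀ z₀ p∈ASM)) (mex₁-bit-not (special (π n p))))
        (IsMex-singleton _ (λ _ → optionValue-unique {n} {grundyFormula n}) (optionValue-self {n} {grundyFormula n} p∈ASM))

foldr-⊕-cong : ∀ {g g′ : X → ℕ} xs → (∀ t → t ∈ xs → g t ≡ g′ t) →
               foldr (λ t acc → g t ⊕ acc) 0 xs ≡ foldr (λ t acc → g′ t ⊕ acc) 0 xs
foldr-⊕-cong []       agree = refl
foldr-⊕-cong (x ∷ xs) agree = cong₂ _⊕_ (agree x (here refl)) (foldr-⊕-cong xs (λ t t∈xs → agree t (there t∈xs)))

xorOver-cong : ∀ n {g g′ : Pt → ℕ} y p → (∀ t → InASM n t → t ≼ y → ¬ t ≡ p → g t ≡ g′ t) →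
               xorOver n g y p ≡ xorOver n g′ y p
xorOver-cong n y p agree = foldr-⊕-cong (filter (Λ∖? y p) (asmList n)) λ t t∈ →
  let t∈ASM , t≼y , t≢p = ∈-filter⁻ (Λ∖? y p) {xs = asmList n} t∈
  in  agree t (proj₂ (∈-filter⁻ (InASM? n) {xs = box (suc (n ∸ 2))} t∈ASM)) t≼y t≢p

rank : ℕ → Pt → ℕ
rank n (x , y , z) = (n ∸ 2 ∸ x) + (n ∸ 2 ∸ y) + z

rank-< : ∀ {n t p} → InASM n t → t ≼ p → ¬ t ≡ p → rank n t < rank n p
rank-< {n} {x , y , z} {x₀ , y₀ , z₀} t∈ASM (x₀≤x , y₀≤y , z≤z₀ , _) t≢p
  with m≤n⇒m<n∨m≡n x₀≤x | m≤n⇒m<n∨m≡n y₀≤y | m≤n⇒m<n∨m≡n z≤z₀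
... | inj₁ x₀<x | _         | _ = +-mono-<-≤ (+-mono-<-≤ (∸-monoʳ-< x₀<x x≤N) (∸-monoʳ-≤ N y₀≤y)) z≤z₀
  where N = n ∸ 2
        x≤N = ≤-trans (≤-trans (m≤m+n x y) (m≤m+n (x + y) z)) t∈ASM
... | inj₂ refl | inj₁ y₀<y | _ = +-mono-<-≤ (+-monoʳ-< (n ∸ 2 ∸ x) (∸-monoʳ-< y₀<y y≤N)) z≤z₀
  where y≤N = ≤-trans (≤-trans (m≤n+m y x) (m≤m+n (x + y) z)) t∈ASM
... | inj₂ refl | inj₂ refl | inj₁ z<z₀ = +-monoʳ-< (n ∸ 2 ∸ x + (n ∸ 2 ∸ y)) z<z₀
... | inj₂ refl | inj₂ refl | inj₂ refl = contradiction refl t≢p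

grundy-unique : ∀ {n g g′} → IsGrundy n g → IsGrundy n g′ → ∀ p → InASM n p → g p ≡ g′ p
grundy-unique {n} {g} {g′} grundy grundy′ p p∈ASM = below (suc (rank n p)) p p∈ASM ≤-refl
  where
  below : ∀ k p → InASM n p → rank n p < k → g p ≡ g′ p
  below (suc k) p p∈ASM rank<1+k = begin
    g p                      ≡⟨ grundy-mex {n} grundy p∈ASM ⟩
    mex₁ (xorOver n g p p)   ≡⟨ cong mex₁ (xorOver-cong n p p (λ t t∈ASM t≼p t≢p →
                                  below k t t∈ASM (<-≤-trans (rank-< {n} t∈ASM t≼p t≢p) (≤-pred rank<1+k)))) ⟩
    mex₁ (xorOver n g′ p p)  ≡⟨ sym (grundy-mex {n} grundy′ p∈ASM) ⟩
    g′ p                     ∎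

grundyFormula-value : ∀ n p → FormulaValue n p (grundyFormula n p)
grundyFormula-value n p with special (π n p) in sp
... | true  = inj₁ (special⇒Special _ _ sp , refl)
... | false = inj₂ ((λ Sp → contradiction (trans (sym sp) (Special⇒special _ _ Sp)) λ ()) , refl)

mainTheorem7 : (n : ℕ) → 0 < n →
    ((g : Pt → ℕ) → IsGrundy n g → (p : Pt) → InASM n p → FormulaValue n p (g p))
    × Data.Product.∃ (λ (g : Pt → ℕ) → IsGrundy n g)
mainTheorem7 n _ =
  (λ g grundy p p∈ASM → subst (FormulaValue n p) (sym (grundy-unique {n} grundy (grundyFormula-isGrundy n) p p∈ASM))
                                                  (grundyFormula-value n p))
  , grundyFormula n , grundyFormula-isGrundy n
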